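{- Let $n, m_1,h_1,m_2,h_2,\dots,m_l,h_l$ be positive integers with \[ n\ge m_1+h_1\ge m_1>m_2+h_2\ge m_2>\cdots>m_l+h_l\ge m_l, \] and let $F_1$ be a union-free family of subsets of $[n-h_1+1,n]$, and for $j=2,\dots,l$ let $F_j$ be a union-free family of subsets of $[m_{j-1}-h_j,\,m_{j-1}-1]$ (each $F_j$ may contain $\emptyset$). Then the family \[ \Big(\binom{[n-h_1]}{m_1}\oplus F_1\Big)\cup\Big(\binom{[m_1-h_2-1]}{m_2}\oplus F_2\Big)\cup\cdots\cup\Big(\binom{[m_{l-1}-h_l-1]}{m_l}\oplus F_l\Big) \] is union-free.
   Context: $[n]=\{1,\dots,n\}$; $[a,b]=\{a,a+1,\dots,b\}$ for integers $a\le b$ and $[a,b]=\emptyset$ for $a>b$; $\binom{S}{k}$ is the family of $k$-element subsets of $S$. For families $F_1,F_2$ of sets, $F_1\oplus F_2=\{A_1\cup A_2: A_1\in F_1, A_2\in F_2\}$. A finite family of sets is union-free if no member equals the union of one or more other members of the family. -}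

module Defs where

open import Data.Nat using (ℕ; suc; _≤_; _<_; _+_; _∸_)
open import Data.Fin using (Fin; toℕ)
open import Data.Fin.Subset using (Subset; _∈_; _∪_; ⋃; ∣_∣)
open import Data.List using (List; [])
open import Data.List.Relation.Unary.All using (All)
open import Data.Product using (Σ; _×_; ∃)
open import Relation.Binary.PropositionalEquality using (_≡_; _≢_)

-- Convention: a subset S of [n] = {1,…,n} is a 'Subset n'; the index
-- i : Fin n represents the element  toℕ i + 1  of [n].
elt : {n : ℕ} → Fin n → ℕ
elt i = suc (toℕ i)

-- A finite family of subsets of [n] is a predicate on 'Subset n'
-- (automatically finite, since Subset n is finite).
Family : ℕ → Set₁
Family n = Subset n → Set

InInterval : {n : ℕ} → ℕ → ℕ → Subset n → Set
InInterval a b S = ∀ i → i ∈ S → a ≤ elt i × elt i ≤ b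

Binom : (n : ℕ) → ℕ → ℕ → Family n
Binom n a k S = InInterval 1 a S × ∣ S ∣ ≡ k

_⊕_ : {n : ℕ} → Family n → Family n → Family n
(F₁ ⊕ F₂) S = Σ _ λ A → Σ _ λ B → F₁ A × F₂ B × S ≡ A ∪ B

-- union-free: no member equals the union of one or more other members.
-- "one or more other members" = a nonempty list of members of F, each
-- different from A (repetitions in the list are harmless).
UnionFree : {n : ℕ} → Family n → Set
UnionFree F = ∀ A → F A → (G : List (Subset _)) → G ≢ [] →
  All (λ B → F B × B ≢ A) G → ⋃ G ≢ A

-- Write the j-th block as Kⱼ ∪ Pⱼ with Kⱼ ⊆ [cⱼ], |Kⱼ| = mⱼ and Pⱼ ∈ Fⱼ lying in
-- [cⱼ + 1, dⱼ]. If A = K ∪ P from block j is a union of other members B ⊆ A, then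
-- no B comes from an earlier block (its kernel has m_{j'} > dⱼ elements inside
-- A ⊆ [dⱼ]), every B from a later block lies below mⱼ and so misses P, and every
-- B from block j has kernel K (same size, contained in K) and a part Q ∈ Fⱼ with
-- Q ≠ P. Since K cannot be covered by sets below mⱼ, some B of block j occurs, and
-- the parts Q then cover exactly P, contradicting union-freeness of Fⱼ.
module Submission where

open import Defs
open import Data.Nat using (ℕ; zero; suc; pred; _≤_; _≤′_; ≤′-refl; ≤′-step; _<_; _+_; _∸_; z≤n; s≤s; s≤s⁻¹; >-nonZero)
open import Data.Nat.Properties
open import Data.Fin using (Fin) renaming (zero to fzero; suc to fsuc)
open import Data.Fin.Subset using (Subset; _∈_; _∉_; _⊆_; _∪_; ⋃; ∣_∣; inside; outside)
open import Data.Fin.Subset.Properties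
  using (_∈?_; ⊆-antisym; p⊂q⇒∣p∣<∣q∣; x∈p∪q⁻; p⊆p∪q; q⊆p∪q; ∉⊥)
open import Data.Vec.Base using (_∷_; []; here; there)
open import Data.List using (List; []; _∷_)
open import Data.List.Relation.Unary.All as All using (All; []; _∷_)
open import Data.Product as Product using (Σ; _×_; _,_; proj₁; proj₂)
open import Data.Sum as Sum using (_⊎_; inj₁; inj₂; [_,_])
open import Data.Empty using (⊥-elim)
open import Function using (id)
open import Relation.Nullary using (yes; no; ¬_; contradiction)
open import Relation.Binary using (tri<; tri≈; tri>)
open import Relation.Binary.PropositionalEquality
  using (_≡_; _≢_; refl; sym; trans; cong; cong₂; subst)

private variable
  n : ℕ
  x : Fin n
  p q : Subset n

_⊆[_] : Subset n → ℕ → Set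
p ⊆[ k ] = ∀ x → x ∈ p → elt x ≤ k

⊆[k]⇒∣p∣≤k : ∀ k (p : Subset n) → p ⊆[ k ] → ∣ p ∣ ≤ k
⊆[k]⇒∣p∣≤k k       []            _      = z≤n
⊆[k]⇒∣p∣≤k k       (outside ∷ p) p⊆[k] = ⊆[k]⇒∣p∣≤k k p (λ x x∈p → ≤-trans (n≤1+n _) (p⊆[k] (fsuc x) (there x∈p)))
⊆[k]⇒∣p∣≤k zero    (inside ∷ p)  p⊆[k] with () ← p⊆[k] fzero here
⊆[k]⇒∣p∣≤k (suc k) (inside ∷ p)  p⊆[k] = s≤s (⊆[k]⇒∣p∣≤k k p (λ x x∈p → s≤s⁻¹ (p⊆[k] (fsuc x) (there x∈p))))

p⊆q∧∣q∣≤∣p∣⇒p≡q : p ⊆ q → ∣ q ∣ ≤ ∣ p ∣ → p ≡ q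
p⊆q∧∣q∣≤∣p∣⇒p≡q {p = p} {q} p⊆q ∣q∣≤∣p∣ = ⊆-antisym p⊆q q⊆p
  where
  q⊆p : q ⊆ p
  q⊆p {x} x∈q with x ∈? p
  ... | yes x∈p = x∈p
  ... | no x∉p = contradiction ∣q∣≤∣p∣ (<⇒≱ (p⊂q⇒∣p∣<∣q∣ (p⊆q , x , x∈q , x∉p)))

x∈p∪q∧x∉p⇒x∈q : x ∈ p ∪ q → x ∉ p → x ∈ q
x∈p∪q∧x∉p⇒x∈q {p = p} {q} x∈p∪q x∉p = [ (λ x∈p → contradiction x∈p x∉p) , id ] (x∈p∪q⁻ p q x∈p∪q)

x∈p∪q∧x∉q⇒x∈p : x ∈ p ∪ q → x ∉ q → x ∈ p
x∈p∪q∧x∉q⇒x∈p {p = p} {q} x∈p∪q x∉q = [ id , (λ x∈q → contradiction x∈q x∉q) ] (x∈p∪q⁻ p q x∈p∪q)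

⊆⋃ : (G : List (Subset n)) → All (_⊆ ⋃ G) G
⊆⋃ []      = []
⊆⋃ (B ∷ G) = p⊆p∪q (⋃ G) ∷ All.map (λ B⊆⋃G {x} x∈ → q⊆p∪q B (⋃ G) (B⊆⋃G x∈)) (⊆⋃ G)

⋃-All : {R : Fin n → Set} {G : List (Subset n)} →
  All (λ B → ∀ x → x ∈ B → R x) G → ∀ x → x ∈ ⋃ G → R x
⋃-All []                       x x∈⋃ = ⊥-elim (∉⊥ x∈⋃)
⋃-All {G = B ∷ G} (RB ∷ RG) x x∈⋃ = [ RB x , ⋃-All RG x ] (x∈p∪q⁻ B (⋃ G) x∈⋃)

unionFree-subfamily : {F F′ : Family n} → (∀ S → F S → F′ S) → UnionFree F′ → UnionFree F
unionFree-subfamily F⊆F′ uf A FA G G≢[] members =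
  uf A (F⊆F′ A FA) G G≢[] (All.map (Product.map₁ (F⊆F′ _)) members)

Lifted : Family n → Subset n → Subset n → Subset n → Set
Lifted F K P B = Σ (Subset _) λ Q → (F Q × Q ≢ P) × B ≡ K ∪ Q

module _ {F : Family n} {K P : Subset n} {Low : Fin n → Set} where

  private
    Kind : Subset n → Set
    Kind B = Lifted F K P B ⊎ (∀ x → x ∈ B → Low x)

  uppers : {G : List (Subset n)} → All Kind G → List (Subset n)
  uppers []                   = []
  uppers (inj₁ (Q , _) ∷ ks) = Q ∷ uppers ks
  uppers (inj₂ _ ∷ ks)       = uppers ks

  uppers-lifted : {G : List (Subset n)} (ks : All Kind G) → All (λ Q → F Q × Q ≢ P) (uppers ks)
  uppers-lifted []                        = []
  uppers-lifted (inj₁ (_ , FQ≢P , _) ∷ ks) = FQ≢P ∷ uppers-lifted ks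
  uppers-lifted (inj₂ _ ∷ ks)             = uppers-lifted ks

  low-if-no-uppers : {G : List (Subset n)} (ks : All Kind G) → uppers ks ≡ [] →
    All (λ B → ∀ x → x ∈ B → Low x) G
  low-if-no-uppers []               _    = []
  low-if-no-uppers (inj₂ low ∷ ks) none = low ∷ low-if-no-uppers ks none

  ⋃uppers⊆⋃ : {G : List (Subset n)} (ks : All Kind G) → ⋃ (uppers ks) ⊆ ⋃ G
  ⋃uppers⊆⋃ [] x∈ = x∈
  ⋃uppers⊆⋃ {G = _ ∷ G} (inj₁ (Q , _ , refl) ∷ ks) {x} x∈ with x∈p∪q⁻ Q (⋃ (uppers ks)) x∈
  ... | inj₁ x∈Q = p⊆p∪q (⋃ G) (q⊆p∪q K Q x∈Q)
  ... | inj₂ x∈r = q⊆p∪q (K ∪ Q) (⋃ G) (⋃uppers⊆⋃ ks x∈r)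
  ⋃uppers⊆⋃ {G = B ∷ _} (inj₂ _ ∷ ks) x∈ = q⊆p∪q B _ (⋃uppers⊆⋃ ks x∈)

  ⋃⊆K∪⋃uppers : {G : List (Subset n)} (ks : All Kind G) →
    ∀ x → x ∈ ⋃ G → ¬ Low x → x ∈ K ⊎ x ∈ ⋃ (uppers ks)
  ⋃⊆K∪⋃uppers [] x x∈ _ = ⊥-elim (∉⊥ x∈)
  ⋃⊆K∪⋃uppers {G = _ ∷ G} (inj₁ (Q , _ , refl) ∷ ks) x x∈ ¬low with x∈p∪q⁻ (K ∪ Q) (⋃ G) x∈
  ... | inj₁ x∈K∪Q = Sum.map₂ (p⊆p∪q _) (x∈p∪q⁻ K Q x∈K∪Q)
  ... | inj₂ x∈r   = Sum.map₂ (q⊆p∪q Q _) (⋃⊆K∪⋃uppers ks x x∈r ¬low)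
  ⋃⊆K∪⋃uppers {G = B ∷ G} (inj₂ low ∷ ks) x x∈ ¬low =
    [ (λ x∈B → contradiction (low x x∈B) ¬low) , (λ x∈r → ⋃⊆K∪⋃uppers ks x x∈r ¬low) ]
      (x∈p∪q⁻ B (⋃ G) x∈)

  ⋃-lifted≢ : UnionFree F → F P →
    (∀ Q → F Q → ∀ x → x ∈ Q → x ∉ K) →
    (∀ x → x ∈ P → ¬ Low x) →
    ¬ (∀ x → x ∈ K → Low x) →
    (G : List (Subset n)) → All (λ B → Lifted F K P B ⊎ (∀ x → x ∈ B → Low x)) G →
    ⋃ G ≢ K ∪ P
  ⋃-lifted≢ uf FP F-avoids-K P-high K-not-low G ks ⋃G≡K∪P =
    uf P FP (uppers ks) uppers≢[] (uppers-lifted ks) (⊆-antisym ⋃uppers⊆P P⊆⋃uppers)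
    where
    ∈⋃G : ∀ {x} → x ∈ K ∪ P → x ∈ ⋃ G
    ∈⋃G {x} = subst (x ∈_) (sym ⋃G≡K∪P)

    uppers≢[] : uppers ks ≢ []
    uppers≢[] none = K-not-low λ x x∈K → ⋃-All (low-if-no-uppers ks none) x (∈⋃G (p⊆p∪q P x∈K))

    ⋃uppers⊆P : ⋃ (uppers ks) ⊆ P
    ⋃uppers⊆P {x} x∈ = x∈p∪q∧x∉p⇒x∈q (subst (x ∈_) ⋃G≡K∪P (⋃uppers⊆⋃ ks x∈))
      (⋃-All (All.map (λ (FQ , _) → F-avoids-K _ FQ) (uppers-lifted ks)) x x∈)

    P⊆⋃uppers : P ⊆ ⋃ (uppers ks)
    P⊆⋃uppers {x} x∈P = [ (λ x∈K → contradiction x∈K (F-avoids-K P FP x x∈P)) , id ]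
      (⋃⊆K∪⋃uppers ks x (∈⋃G (q⊆p∪q K P x∈P)) (P-high x x∈P))

module Layered {n : ℕ} (Active : ℕ → Set) (m c d : ℕ → ℕ) (F : ℕ → Family n)
    (m≥1 : ∀ {j} → Active j → 1 ≤ m j)
    (m≤c : ∀ {j} → Active j → m j ≤ c j)
    (c≤d : ∀ {j} → Active j → c j ≤ d j)
    (separated : ∀ {i k} → Active i → Active k → i < k → d k < m i)
    (F-between : ∀ {j} → Active j → ∀ Q → F j Q → InInterval (suc (c j)) (d j) Q)
    (F-unionFree : ∀ {j} → Active j → UnionFree (F j)) where

  Layer : ℕ → Family n
  Layer j = Binom n (c j) (m j) ⊕ F j

  layer⊆[d] : ∀ {j S} → Active j → Layer j S → S ⊆[ d j ]
  layer⊆[d] aj (K , Q , (K⊆[c] , _) , FQ , refl) x x∈ with x∈p∪q⁻ K Q x∈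
  ... | inj₁ x∈K = ≤-trans (proj₂ (K⊆[c] x x∈K)) (c≤d aj)
  ... | inj₂ x∈Q = proj₂ (F-between aj Q FQ x x∈Q)

  lower-layer-⊈ : ∀ {i k A B} → Active i → Active k → i < k → Layer i B → Layer k A → ¬ B ⊆ A
  lower-layer-⊈ {k = k} ai ak i<k (K , Q , (_ , ∣K∣≡m) , _ , refl) LA B⊆A =
    <⇒≱ (separated ai ak i<k)
      (subst (_≤ d k) ∣K∣≡m (⊆[k]⇒∣p∣≤k (d k) K λ x x∈K → layer⊆[d] ak LA x (B⊆A (p⊆p∪q Q x∈K))))

  higher-layer-< : ∀ {i k B} → Active i → Active k → i < k → Layer k B → ∀ x → x ∈ B → elt x < m i
  higher-layer-< ai ak i<k LB x x∈B = ≤-<-trans (layer⊆[d] ak LB x x∈B) (separated ai ak i<k)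

  same-layer-lifted : ∀ {j K P B} → Active j → Binom n (c j) (m j) K → F j P →
    Layer j B → B ⊆ K ∪ P → B ≢ K ∪ P → Lifted (F j) K P B
  same-layer-lifted {K = K} {P} aj (_ , ∣K∣≡m) FP (K′ , Q , (K′⊆[c] , ∣K′∣≡m) , FQ , refl) B⊆ B≢ =
    Q , (FQ , Q≢P) , cong (_∪ Q) K′≡K
    where
    K′⊆K : K′ ⊆ K
    K′⊆K {x} x∈K′ = x∈p∪q∧x∉q⇒x∈p (B⊆ (p⊆p∪q Q x∈K′))
      λ x∈P → <⇒≱ (proj₁ (F-between aj P FP x x∈P)) (proj₂ (K′⊆[c] x x∈K′))

    K′≡K : K′ ≡ K
    K′≡K = p⊆q∧∣q∣≤∣p∣⇒p≡q K′⊆K (≤-reflexive (trans ∣K∣≡m (sym ∣K′∣≡m)))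

    Q≢P : Q ≢ P
    Q≢P Q≡P = B≢ (cong₂ _∪_ K′≡K Q≡P)

  lifted-or-below : ∀ {j K P B} → Active j → Binom n (c j) (m j) K → F j P →
    (Σ ℕ λ i → Active i × Layer i B) → B ≢ K ∪ P → B ⊆ K ∪ P →
    Lifted (F j) K P B ⊎ (∀ x → x ∈ B → elt x < m j)
  lifted-or-below {j} {K} {P} aj K∈ FP (i , ai , LB) B≢ B⊆ with <-cmp i j
  ... | tri< i<j _ _ = ⊥-elim (lower-layer-⊈ ai aj i<j LB (K , P , K∈ , FP , refl) B⊆)
  ... | tri≈ _ refl _ = inj₁ (same-layer-lifted aj K∈ FP LB B⊆ B≢)
  ... | tri> _ _ j<i = inj₂ (higher-layer-< aj ai j<i LB)

  layers-unionFree : UnionFree (λ S → Σ ℕ λ j → Active j × Layer j S)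
  layers-unionFree _ (j , aj , K , P , K∈@(K⊆[c] , ∣K∣≡m) , FP , refl) G _ members ⋃G≡K∪P =
    ⋃-lifted≢ (F-unionFree aj) FP F-avoids-K P-high K-not-low G
      (All.zipWith (λ ((LB , B≢) , B⊆⋃G) → lifted-or-below aj K∈ FP LB B≢ (⊆K∪P (λ {x} → B⊆⋃G {x}))) (members , ⊆⋃ G))
      ⋃G≡K∪P
    where
    ⊆K∪P : ∀ {B} → B ⊆ ⋃ G → B ⊆ K ∪ P
    ⊆K∪P B⊆⋃G {x} x∈B = subst (x ∈_) ⋃G≡K∪P (B⊆⋃G x∈B)

    F-avoids-K : ∀ Q → F j Q → ∀ x → x ∈ Q → x ∉ K
    F-avoids-K Q FQ x x∈Q x∈K = <⇒≱ (proj₁ (F-between aj Q FQ x x∈Q)) (proj₂ (K⊆[c] x x∈K))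

    P-high : ∀ x → x ∈ P → ¬ elt x < m j
    P-high x x∈P x<m = <⇒≱ (proj₁ (F-between aj P FP x x∈P)) (≤-trans (<⇒≤ x<m) (m≤c aj))

    K-not-low : ¬ (∀ x → x ∈ K → elt x < m j)
    K-not-low low = <⇒≱ (∸-monoʳ-< (s≤s z≤n) (m≥1 aj))
      (subst (_≤ pred (m j)) ∣K∣≡m (⊆[k]⇒∣p∣≤k (pred (m j)) K λ x x∈K → <⇒≤pred (low x x∈K)))

module Chain (n l : ℕ) (m h : ℕ → ℕ) (F : ℕ → Family n)
    (m,h≥1 : ∀ j → 1 ≤ j → j ≤ l → 1 ≤ m j × 1 ≤ h j)
    (m₁+h₁≤n : m 1 + h 1 ≤ n)
    (decreasing : ∀ j → 2 ≤ j → j ≤ l → m j + h j < m (j ∸ 1))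
    (F₁-between : ∀ S → F 1 S → InInterval (n ∸ h 1 + 1) n S)
    (Fⱼ-between : ∀ j → 2 ≤ j → j ≤ l → ∀ S → F j S → InInterval (m (j ∸ 1) ∸ h j) (m (j ∸ 1) ∸ 1) S)
    (Fⱼ-unionFree : ∀ j → 1 ≤ j → j ≤ l → UnionFree (F j)) where

  Active : ℕ → Set
  Active j = 1 ≤ j × j ≤ l

  -- Block j is Binom [cⱼ] mⱼ ⊕ Fⱼ with Fⱼ inside [cⱼ + 1, dⱼ]; index 0 is inactive.
  c : ℕ → ℕ
  c zero          = 0
  c 1             = n ∸ h 1
  c (suc (suc k)) = pred (m (suc k) ∸ h (suc (suc k)))

  d : ℕ → ℕ
  d zero          = 0
  d 1             = n
  d (suc (suc k)) = pred (m (suc k))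

  m≥1 : ∀ {j} → Active j → 1 ≤ m j
  m≥1 (1≤j , j≤l) = proj₁ (m,h≥1 _ 1≤j j≤l)

  m-antitone : ∀ {i k} → 1 ≤ i → i ≤ k → k ≤ l → m k ≤ m i
  m-antitone {i} 1≤i i≤k = go (≤⇒≤′ i≤k)
    where
    go : ∀ {k} → i ≤′ k → k ≤ l → m k ≤ m i
    go ≤′-refl                  _     = ≤-refl
    go (≤′-step {k} i≤′k) 1+k≤l =
      ≤-trans (≤-trans (m≤m+n _ _) (<⇒≤ (decreasing (suc k) (s≤s (≤-trans 1≤i (≤′⇒≤ i≤′k))) 1+k≤l)))
              (go i≤′k (≤-trans (n≤1+n k) 1+k≤l))

  m≤c : ∀ {j} → Active j → m j ≤ c j
  m≤c {1}           _          = m+n≤o⇒m≤o∸n (m 1) m₁+h₁≤n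
  m≤c {suc (suc k)} (_ , j≤l) = <⇒≤pred (m+n≤o⇒m≤o∸n (suc (m (suc (suc k)))) (decreasing _ (s≤s (s≤s z≤n)) j≤l))

  c≤d : ∀ {j} → Active j → c j ≤ d j
  c≤d {1}           _ = m∸n≤m n (h 1)
  c≤d {suc (suc k)} _ = pred-mono-≤ (m∸n≤m (m (suc k)) (h (suc (suc k))))

  separated : ∀ {i k} → Active i → Active k → i < k → d k < m i
  separated {k = 1} (s≤s _ , _) _ (s≤s ())
  separated {k = suc (suc k)} (1≤i , _) (_ , k≤l) (s≤s i≤1+k) =
    <-≤-trans (∸-monoʳ-< (s≤s z≤n) (m≥1 (s≤s z≤n , 1+k≤l))) (m-antitone 1≤i i≤1+k 1+k≤l)
    where
    1+k≤l : suc k ≤ l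
    1+k≤l = ≤-trans (n≤1+n _) k≤l

  F-between : ∀ {j} → Active j → ∀ Q → F j Q → InInterval (suc (c j)) (d j) Q
  F-between {1} _ Q FQ = subst (λ a → InInterval a n Q) (+-comm (n ∸ h 1) 1) (F₁-between Q FQ)
  F-between {j@(suc (suc k))} (_ , j≤l) Q FQ =
    subst (λ a → InInterval a (pred (m (suc k))) Q) (sym (suc-pred _ ⦃ >-nonZero (m<n⇒0<n∸m hⱼ<m) ⦄))
      (Fⱼ-between j (s≤s (s≤s z≤n)) j≤l Q FQ)
    where
    hⱼ<m : h j < m (suc k)
    hⱼ<m = ≤-<-trans (m≤n+m (h j) (m j)) (decreasing j (s≤s (s≤s z≤n)) j≤l)

  F-unionFree : ∀ {j} → Active j → UnionFree (F j)
  F-unionFree (1≤j , j≤l) = Fⱼ-unionFree _ 1≤j j≤l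

  open Layered Active m c d F m≥1 m≤c c≤d separated F-between F-unionFree public

  blocks⊆layers : ∀ S → (Σ ℕ λ j → 1 ≤ j × j ≤ l ×
      ((1 ≡ j × (Binom n (n ∸ h 1) (m 1) ⊕ F 1) S)
       ⊎ (2 ≤ j × (Binom n (m (j ∸ 1) ∸ h j ∸ 1) (m j) ⊕ F j) S))) →
    Σ ℕ λ j → Active j × Layer j S
  blocks⊆layers S (_ , 1≤j , j≤l , inj₁ (refl , S∈)) = 1 , (1≤j , j≤l) , S∈
  blocks⊆layers S (suc (suc _) , 1≤j , j≤l , inj₂ (_ , S∈)) = _ , (1≤j , j≤l) , S∈
  blocks⊆layers S (1 , _ , _ , inj₂ (s≤s () , _))

mainTheorem5 : (n l : ℕ) (m h : ℕ → ℕ) (F : ℕ → Family n) →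
    1 ≤ n → 1 ≤ l →
    (∀ j → 1 ≤ j → j ≤ l → 1 ≤ m j × 1 ≤ h j) →
    m 1 + h 1 ≤ n →
    (∀ j → 2 ≤ j → j ≤ l → m j + h j < m (j ∸ 1)) →
    (∀ S → F 1 S → InInterval (n ∸ h 1 + 1) n S) →
    (∀ j → 2 ≤ j → j ≤ l → ∀ S → F j S → InInterval (m (j ∸ 1) ∸ h j) (m (j ∸ 1) ∸ 1) S) →
    (∀ j → 1 ≤ j → j ≤ l → UnionFree (F j)) →
    UnionFree (λ S → Σ ℕ λ j → 1 ≤ j × j ≤ l ×
      ((1 ≡ j × (Binom n (n ∸ h 1) (m 1) ⊕ F 1) S)
       ⊎ (2 ≤ j × (Binom n (m (j ∸ 1) ∸ h j ∸ 1) (m j) ⊕ F j) S)))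
mainTheorem5 n l m h F _ _ m,h≥1 m₁+h₁≤n decreasing F₁-between Fⱼ-between Fⱼ-unionFree =
  unionFree-subfamily blocks⊆layers layers-unionFree
  where open Chain n l m h F m,h≥1 m₁+h₁≤n decreasing F₁-between Fⱼ-between Fⱼ-unionFree
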